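{- Let $\mathcal{L}=(D,A,B,\mathcal{P})$ be a partially linked web and $\widehat{A}=A\setminus\mathsf{in}(\mathcal{P})$. If $\widehat{A}\neq\emptyset$ and there is no augmenting trail in $\mathcal{L}$, then the web $(D,A,B)$ is hindered.
   Context: A digraph is a pair $D=(V,E)$ with $E\subseteq (V\times V)\setminus\{vv\}$ and $uv\in E\Rightarrow vu\notin E$; it may be infinite. A web $(D,A,B)$ has $A,B\subseteq V$, no edges into $A$, no edges out of $B$. A path is a trivial vertex or a finite directed path without repeated vertices; an $XY$-path is trivial at a vertex of $X\cap Y$ or nontrivial from $X$ to $Y$ with interior vertices outside $X\cup Y$. A partial linkage is a set $\mathcal{P}$ of pairwise vertex-disjoint $AB$-paths; $(D,A,B,\mathcal{P})$ is a partially linked web. Put $\widehat{A}=A\setminus\mathsf{in}(\mathcal{P})$, $\widehat{B}=B\setminus\mathsf{ter}(\mathcal{P})$, $V(\mathcal{P})$, $E(\mathcal{P})$ the vertices and edges used by $\mathcal{P}$. Let $D^*=(V,E^*)$ be obtained from $D$ by reversing the edges in $E(\mathcal{P})$. A trail is a single vertex, or a finite sequence $(v_0v_1,\dots,v_{n-1}v_n)$ of pairwise distinct edges. The alternating trails of $\mathcal{L}$ are the trivial trails $v\in\widehat{A}$ and the nontrivial sequences $T=(v_0v_1,\dots,v_{n-1}v_n)$ such that: (1) $T$ is a trail in $D^*$; (2) $v_0\in\widehat{A}$; (3) if $v_i=v_j$ with $i<j$, then $v_i\in V(\mathcal{P})$ and $j\neq n$; (4) if $v_i\in V(\mathcal{P})$,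 $v_{i-1}v_i\in E^*\cap E$ and $i<n$, then $v_iv_{i+1}\in E^*\setminus E$. An alternating trail is augmenting if it terminates in $\widehat{B}$. A hindrance of $(D,A,B)$ is a set $\mathcal{H}$ of pairwise disjoint $AS$-paths with $S$ an $AB$-separator (a set meeting all $AB$-paths), $\mathsf{ter}(\mathcal{H})=S$ and $\mathsf{in}(\mathcal{H})\subsetneq A$; the web is hindered if one exists. -}

module Defs where

open import Level using (0ℓ)
open import Data.Nat using (ℕ; zero; suc; _<_; _≤_)
open import Data.List using (List; []; _∷_; _++_)
open import Data.List.Relation.Unary.All using (All)
open import Data.List.Relation.Unary.Linked using (Linked)
open import Data.List.Relation.Unary.Unique.Propositional using (Unique)
open import Data.List.Membership.Propositional using (_∈_)
open import Data.Product using (Σ; ∃; ∃₂; _×_; _,_)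
open import Data.Sum using (_⊎_)
open import Relation.Nullary using (¬_)
open import Data.Empty using (⊥)
open import Relation.Binary.PropositionalEquality using (_≡_; _≢_)

record Digraph : Set₁ where
  field
    V      : Set
    E      : V → V → Set
    irrefl : ∀ v → ¬ E v v
    asym   : ∀ u v → E u v → ¬ E v u

lastOf : {X : Set} → X → List X → X
lastOf x []       = x
lastOf x (y ∷ ys) = lastOf y ys

dropLast : {X : Set} → List X → List X
dropLast []           = []
dropLast (x ∷ [])     = []
dropLast (x ∷ y ∷ ys) = x ∷ dropLast (y ∷ ys)

module _ (D : Digraph) where
  open Digraph D

  record Path : Set where
    field
      first  : V
      rest   : List V
      linked : Linked E (first ∷ rest)
      unique : Unique (first ∷ rest)

  verts : Path → List V
  verts p = Path.first p ∷ Path.rest p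

  ini : Path → V
  ini p = Path.first p

  ter : Path → V
  ter p = lastOf (Path.first p) (Path.rest p)

  interior : Path → List V
  interior p = dropLast (Path.rest p)

  EdgeOn : Path → V → V → Set
  EdgeOn p u v = ∃₂ λ xs ys → verts p ≡ xs ++ (u ∷ v ∷ ys)

  -- XY-path: trivial at a vertex of X ∩ Y, or nontrivial from X to Y
  -- with interior outside X ∪ Y.
  IsXYPath : (V → Set) → (V → Set) → Path → Set
  IsXYPath X Y p = X (ini p) × Y (ter p) × All (λ v → ¬ X v × ¬ Y v) (interior p)

  IsSeparator : (V → Set) → (V → Set) → (V → Set) → Set
  IsSeparator A B S = ∀ (p : Path) → IsXYPath A B p → ∃ λ v → v ∈ verts p × S v

  IsWeb : (V → Set) → (V → Set) → Set
  IsWeb A B = (∀ u v → E u v → ¬ A v) × (∀ u v → E u v → ¬ B u)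

  PairwiseDisjoint : {I : Set} → (I → Path) → Set
  PairwiseDisjoint {I} P = ∀ (i j : I) → i ≢ j → ∀ v → v ∈ verts (P i) → v ∈ verts (P j) → ⊥

  IsPartialLinkage : (V → Set) → (V → Set) → {I : Set} → (I → Path) → Set
  IsPartialLinkage A B P = (∀ i → IsXYPath A B (P i)) × PairwiseDisjoint P

  IsHindrance : (V → Set) → (V → Set) → {J : Set} → (J → Path) → Set₁
  IsHindrance A B {J} H =
    Σ (V → Set) λ S →
      PairwiseDisjoint H
      × (∀ j → IsXYPath A S (H j))
      × IsSeparator A B S
      × (∀ v → (S v → ∃ λ j → ter (H j) ≡ v) × ((∃ λ j → ter (H j) ≡ v) → S v))
      × (∀ v → (∃ λ j → ini (H j) ≡ v) → A v)
      × (∃ λ a → A a × ¬ (∃ λ j → ini (H j) ≡ a))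

  Hindered : (V → Set) → (V → Set) → Set₁
  Hindered A B = Σ Set λ J → Σ (J → Path) λ H → IsHindrance A B H

  module Linked-Web (A B : V → Set) {I : Set} (P : I → Path) where

    Â : V → Set
    Â v = A v × ¬ (∃ λ i → ini (P i) ≡ v)

    B̂ : V → Set
    B̂ v = B v × ¬ (∃ λ i → ter (P i) ≡ v)

    VP : V → Set
    VP v = ∃ λ i → v ∈ verts (P i)

    EP : V → V → Set
    EP u v = ∃ λ i → EdgeOn (P i) u v

    E* : V → V → Set
    E* u v = (E u v × ¬ EP u v) ⊎ (E v u × EP v u)

    -- An alternating trail with vertex sequence w 0, …, w n (n edges);
    -- n = 0 is the trivial trail at w 0 ∈ Â. Only w 0 … w n matter.
    IsAltTrail : (n : ℕ) → (ℕ → V) → Set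
    IsAltTrail n w =
      (∀ i → i < n → E* (w i) (w (suc i)))
      × (∀ i j → i < j → j < n → ¬ (w i ≡ w j × w (suc i) ≡ w (suc j)))
      × Â (w 0)
      × (∀ i j → i < j → j ≤ n → w i ≡ w j → VP (w i) × j ≢ n)
      -- (4)  (index i = suc k, with 0 < i < n)
      × (∀ k → suc k < n → VP (w (suc k))
           → (E* (w k) (w (suc k)) × E (w k) (w (suc k)))
           → (E* (w (suc k)) (w (suc (suc k))) × ¬ E (w (suc k)) (w (suc (suc k)))))

    IsAugmenting : (n : ℕ) → (ℕ → V) → Set
    IsAugmenting n w = IsAltTrail n w × B̂ (w n)

{-# OPTIONS --safe #-}

-- Give each vertex of an alternating trail a mode: fwd if it was entered along an edge of D
-- outside 𝒫, bwd if it was entered along a reversed edge of 𝒫 or is the start. Condition (4)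
-- then only restricts single steps (a vertex of 𝒫 entered in mode fwd must be left backwards),
-- and alternating trails are the vertex sequences of walks in the digraph of states (v , mode)
-- that repeat no state: a vertex recurs only in both modes, so it lies on 𝒫, and an edge
-- determines the mode it enters, so no edge recurs.
-- Now cut every path of 𝒫 after its last vertex reached by such a walk, and let S be the set of
-- the new end vertices. Walking backwards along a path of 𝒫 reaches every vertex before its cut
-- point in mode bwd, so every vertex of an AB-path avoiding S is reached in a state that allows
-- forward steps. Its end in B is then off 𝒫 (a vertex before a cut point has an out-edge), which
-- gives an augmenting trail. Hence S separates A from B and the cut paths form a hindrance; their
-- initial vertices miss the start vertices in Â.
module Submission where

open import Defs
open import Level using (0ℓ)
open import Axiom.ExcludedMiddle using (ExcludedMiddle)
open import Data.Nat using (ℕ; zero; suc; _<_; _≤_; _≤?_; z≤n; s≤s)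
open import Data.Nat.Properties
  using ( ≤-refl; ≤-trans; <-≤-trans; <-trans; <⇒≤; n<1+n; n≮0; 1+n≰n
        ; m<1+n⇒m≤n; m<1+n⇒m<n∨m≡n; m≤n⇒m<n∨m≡n )
open import Data.List using (List; []; _∷_; _++_)
open import Data.List.Properties using (∷-injective; ++-assoc)
open import Data.List.Relation.Unary.All as All using (All; []; _∷_)
open import Data.List.Relation.Unary.All.Properties using () renaming (++⁻ˡ to All-++⁻ˡ)
open import Data.List.Relation.Unary.AllPairs using ([]; _∷_)
open import Data.List.Relation.Unary.Any using (here; there)
open import Data.List.Relation.Unary.Linked as Linked using (Linked; []; [-]; _∷_)
open import Data.List.Relation.Unary.Unique.Propositional using (Unique)
open import Data.List.Membership.Propositional using (_∈_)
open import Data.List.Membership.Propositional.Properties using (∈-++⁺ˡ; ∈-++⁺ʳ; ∈-++⁻)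
open import Data.Product using (Σ; ∃; ∃₂; _×_; _,_; proj₁; proj₂; map₂)
open import Data.Sum using (_⊎_; inj₁; inj₂)
open import Data.Empty using (⊥-elim)
open import Function using (_∘_; id)
open import Relation.Nullary using (¬_; yes; no; contradiction)
open import Relation.Unary using (Decidable)
open import Relation.Binary.PropositionalEquality
  using (_≡_; _≢_; refl; sym; trans; cong; cong₂; subst; subst₂)

module _ {X : Set} where

  lastOf-∈ : ∀ x l → lastOf {X} x l ∈ x ∷ l
  lastOf-∈ x []      = here refl
  lastOf-∈ x (y ∷ l) = there (lastOf-∈ y l)

  Linked-++⁻ˡ : ∀ {R : X → X → Set} xs {ys} → Linked R (xs ++ ys) → Linked R xs
  Linked-++⁻ˡ []           _        = []
  Linked-++⁻ˡ (x ∷ [])     _        = [-]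
  Linked-++⁻ˡ (x ∷ y ∷ xs) (r ∷ rs) = r ∷ Linked-++⁻ˡ (y ∷ xs) rs

  Unique-++⁻ˡ : ∀ xs {ys} → Unique {A = X} (xs ++ ys) → Unique xs
  Unique-++⁻ˡ []       _          = []
  Unique-++⁻ˡ (x ∷ xs) (x∉ ∷ uxs) = All-++⁻ˡ xs x∉ ∷ Unique-++⁻ˡ xs uxs

  Consecutive : List X → X → X → Set
  Consecutive l u v = ∃₂ λ xs ys → l ≡ xs ++ u ∷ v ∷ ys

  Consecutive-∷ : ∀ {x l u v} → Consecutive l u v → Consecutive (x ∷ l) u v
  Consecutive-∷ {x} (xs , ys , eq) = x ∷ xs , ys , cong (x ∷_) eq

  Consecutive-++⁺ˡ : ∀ {l u v} ys → Consecutive l u v → Consecutive (l ++ ys) u v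
  Consecutive-++⁺ˡ {u = u} {v} ys (xs , zs , refl) = xs , zs ++ ys , ++-assoc xs (u ∷ v ∷ zs) ys

  Consecutive⇒∈ˡ : ∀ {l u v} → Consecutive l u v → u ∈ l
  Consecutive⇒∈ˡ (xs , _ , refl) = ∈-++⁺ʳ xs (here refl)

  Consecutive⇒∈ʳ : ∀ {l u v} → Consecutive l u v → v ∈ l
  Consecutive⇒∈ʳ (xs , _ , refl) = ∈-++⁺ʳ xs (there (here refl))

  Linked-Consecutive : ∀ l → Linked (Consecutive l) l
  Linked-Consecutive []          = []
  Linked-Consecutive (x ∷ [])    = [-]
  Linked-Consecutive (x ∷ y ∷ l) =
    ([] , l , refl) ∷ Linked.map Consecutive-∷ (Linked-Consecutive (y ∷ l))

  lookup-Consecutive : ∀ {R : X → X → Set} {l u v} → Linked R l → Consecutive l u v → R u v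
  lookup-Consecutive rs ([]     , _  , refl) = Linked.head rs
  lookup-Consecutive rs (_ ∷ xs , ys , refl) = lookup-Consecutive (Linked.tail rs) (xs , ys , refl)

  successor-unique : ∀ (xs xs′ : List X) {u v v′ ys ys′} → Unique (xs ++ u ∷ v ∷ ys) →
                     xs ++ u ∷ v ∷ ys ≡ xs′ ++ u ∷ v′ ∷ ys′ → v ≡ v′
  successor-unique []       []           _         eq = proj₁ (∷-injective (proj₂ (∷-injective eq)))
  successor-unique []       (_ ∷ xs′) {u} (u∉ ∷ _) eq =
    ⊥-elim (All.lookup u∉ (subst (u ∈_) (sym (proj₂ (∷-injective eq))) (∈-++⁺ʳ xs′ (here refl))) refl)
  successor-unique (_ ∷ xs) []           (x∉ ∷ _)  eq =
    ⊥-elim (All.lookup x∉ (∈-++⁺ʳ xs (here refl)) (proj₁ (∷-injective eq)))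
  successor-unique (_ ∷ xs) (_ ∷ xs′)    (_ ∷ uxs) eq =
    successor-unique xs xs′ uxs (proj₂ (∷-injective eq))

  Consecutive-unique : ∀ {l : List X} {u v v′} →
                       Unique l → Consecutive l u v → Consecutive l u v′ → v ≡ v′
  Consecutive-unique ul (xs , _ , refl) (xs′ , _ , eq) = successor-unique xs xs′ ul eq

  ∈⇒predecessor : ∀ (x : X) {l v} → v ∈ l → ∃ λ u → Consecutive (x ∷ l) u v
  ∈⇒predecessor x {l = _ ∷ l} (here refl) = x , [] , l , refl
  ∈⇒predecessor x {l = y ∷ _} (there m)   = map₂ Consecutive-∷ (∈⇒predecessor y m)

  ∈-dropLast⇒successor : ∀ {v : X} l → v ∈ dropLast l → ∃ (Consecutive l v)
  ∈-dropLast⇒successor (x ∷ y ∷ l) (here refl) = y , [] , l , refl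
  ∈-dropLast⇒successor (x ∷ y ∷ l) (there m)   = map₂ Consecutive-∷ (∈-dropLast⇒successor (y ∷ l) m)

  ∈-dropLast⁻ : ∀ {v : X} l → v ∈ dropLast l → v ∈ l
  ∈-dropLast⁻ (x ∷ y ∷ l) (here refl) = here refl
  ∈-dropLast⁻ (x ∷ y ∷ l) (there m)   = there (∈-dropLast⁻ (y ∷ l) m)

  ∈-dropLast-∷ : ∀ {v x : X} l → v ∈ dropLast l → v ∈ dropLast (x ∷ l)
  ∈-dropLast-∷ (_ ∷ _) = there

  ∈-dropLast⁺ : ∀ {v : X} x l → v ∈ x ∷ l → v ≢ lastOf x l → v ∈ dropLast (x ∷ l)
  ∈-dropLast⁺ x []      (here refl) v≢last = contradiction refl v≢last
  ∈-dropLast⁺ x (y ∷ l) (here refl) _      = here refl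
  ∈-dropLast⁺ x (y ∷ l) (there m)   v≢last = there (∈-dropLast⁺ y l m v≢last)

  ∈-dropLast⇒≢lastOf : ∀ {v x : X} {l} → Unique (x ∷ l) → v ∈ dropLast (x ∷ l) → v ≢ lastOf x l
  ∈-dropLast⇒≢lastOf {l = y ∷ l} (x∉ ∷ _)  (here refl) = All.lookup x∉ (lastOf-∈ y l)
  ∈-dropLast⇒≢lastOf {l = y ∷ l} (_ ∷ uyl) (there m)   = ∈-dropLast⇒≢lastOf uyl m

  All-dropLast-backward : ∀ {R : X → X → Set} {Q Q′ : X → Set} →
                          (∀ {u v} → R u v → Q v → Q′ u) → (∀ {v} → Q′ v → Q v) →
                          ∀ {x l} → Linked R (x ∷ l) → Q (lastOf x l) → All Q′ (dropLast (x ∷ l))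
  All-dropLast-backward back weaken [-]               _ = []
  All-dropLast-backward back weaken (r ∷ [-])         q = back r q ∷ []
  All-dropLast-backward back weaken (r ∷ rs@(_ ∷ _)) q with All-dropLast-backward back weaken rs q
  ... | q′y ∷ q′s = back r (weaken q′y) ∷ q′y ∷ q′s

  lastOf-forward : ∀ {R : X → X → Set} {N Q : X → Set} →
                   (∀ {u v} → R u v → N u → N v → Q u → Q v) →
                   ∀ {x l} → Linked R (x ∷ l) → All N (x ∷ l) → Q x → Q (lastOf x l)
  lastOf-forward forward [-]      _                   q = q
  lastOf-forward forward (r ∷ rs) (nx ∷ nyl@(ny ∷ _)) q = lastOf-forward forward rs nyl (forward r nx ny q)

  record LastSplit (Pr : X → Set) (x : X) (l : List X) : Set where
    constructor split
    field
      prefix suffix    : List X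
      l≡prefix++suffix : l ≡ prefix ++ suffix
      Pr-at-end        : prefix ≡ [] ⊎ Pr (lastOf x prefix)
      ¬Pr-in-suffix    : All (¬_ ∘ Pr) suffix

  splitAtLast : ∀ {Pr : X → Set} → Decidable Pr → ∀ x l → LastSplit Pr x l
  splitAtLast Pr? x []      = split [] [] refl (inj₁ refl) []
  splitAtLast Pr? x (y ∷ l) with splitAtLast Pr? y l
  ... | split prefix suffix eq (inj₂ p) fails = split (y ∷ prefix) suffix (cong (y ∷_) eq) (inj₂ p) fails
  ... | split [] suffix refl (inj₁ refl) fails with Pr? y
  ...   | yes py = split (y ∷ []) suffix refl (inj₂ py) fails
  ...   | no ¬py = split [] (y ∷ suffix) refl (inj₁ refl) (¬py ∷ fails)

module _ {X : Set} where

  extend : ℕ → (ℕ → X) → X → ℕ → X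
  extend n σ x k with k ≤? n
  ... | yes _ = σ k
  ... | no  _ = x

  extend-≤ : ∀ {n k} σ x → k ≤ n → extend n σ x k ≡ σ k
  extend-≤ {n} {k} σ x k≤n with k ≤? n
  ... | yes _   = refl
  ... | no  k≰n = contradiction k≤n k≰n

  extend-suc : ∀ n σ x → extend n σ x (suc n) ≡ x
  extend-suc n σ x with suc n ≤? n
  ... | yes 1+n≤n = contradiction 1+n≤n 1+n≰n
  ... | no  _     = refl

module _ {D : Digraph} where
  open Digraph D

  initialSegment : (p : Path D) (pre : List V) → (∃ λ post → Path.rest p ≡ pre ++ post) → Path D
  initialSegment p pre (_ , eq) = record
    { first  = Path.first p
    ; rest   = pre
    ; linked = Linked-++⁻ˡ (_ ∷ pre) (subst (λ l → Linked E (_ ∷ l)) eq (Path.linked p))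
    ; unique = Unique-++⁻ˡ (_ ∷ pre) (subst (λ l → Unique (_ ∷ l)) eq (Path.unique p))
    }

data Mode : Set where
  fwd bwd : Mode

fwd≢bwd : fwd ≢ bwd
fwd≢bwd ()

module AlternatingReachability
  (D : Digraph) (A B : Digraph.V D → Set) (web : IsWeb D A B) {I : Set} (P : I → Path D) where
  open Digraph D
  open Linked-Web D A B P

  EP⇒E : ∀ {u v} → EP u v → E u v
  EP⇒E (i , uv) = lookup-Consecutive (Path.linked (P i)) uv

  ForwardOK : V → Mode → Set
  ForwardOK u m = m ≡ bwd ⊎ ¬ VP u

  data Step (u : V) (m : Mode) (v : V) (m′ : Mode) : Set where
    forward  : E u v → ¬ EP u v → ForwardOK u m → m′ ≡ fwd → Step u m v m′
    backward : EP v u → m′ ≡ bwd → Step u m v m′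

  State : Set
  State = V × Mode

  _⟶_ : State → State → Set
  (u , m) ⟶ (v , m′) = Step u m v m′

  data Reachable : State → Set where
    start : ∀ {a} → Â a → Reachable (a , bwd)
    step  : ∀ {σ τ} → Reachable σ → σ ⟶ τ → Reachable τ

  step-E* : ∀ {u m v m′} → Step u m v m′ → E* u v
  step-E* (forward e ¬ep _ _) = inj₁ (e , ¬ep)
  step-E* (backward ep _)     = inj₂ (EP⇒E ep , ep)

  step-mode-unique : ∀ {u m v t u′ m′ v′ t′} →
                     Step u m v t → Step u′ m′ v′ t′ → u ≡ u′ → v ≡ v′ → t ≡ t′
  step-mode-unique (forward _ _ _ t≡fwd) (forward _ _ _ t′≡fwd) _ _ = trans t≡fwd (sym t′≡fwd)
  step-mode-unique (backward _ t≡bwd)    (backward _ t′≡bwd)    _ _ = trans t≡bwd (sym t′≡bwd)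
  step-mode-unique (forward e _ _ _) (backward ep _) refl refl = contradiction (EP⇒E ep) (asym _ _ e)
  step-mode-unique (backward ep _) (forward e _ _ _) refl refl = contradiction (EP⇒E ep) (asym _ _ e)

  entered-bwd⇒VP : ∀ {u m v m′} → Step u m v m′ → m′ ≡ bwd → VP v
  entered-bwd⇒VP (forward _ _ _ refl) ()
  entered-bwd⇒VP (backward (i , vu) _) _ = i , Consecutive⇒∈ˡ vu

  entered-fwd⇒¬A : ∀ {u m v m′} → Step u m v m′ → m′ ≡ fwd → ¬ A v
  entered-fwd⇒¬A (forward e _ _ _) _ = proj₁ web _ _ e
  entered-fwd⇒¬A (backward _ refl) ()

  record StatePath (n : ℕ) (σ : ℕ → State) : Set where
    field
      start-Â   : Â (proj₁ (σ 0))
      start-bwd : proj₂ (σ 0) ≡ bwd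
      steps     : ∀ {i} → i < n → σ i ⟶ σ (suc i)
      injective : ∀ {i j} → i < j → j ≤ n → σ i ≢ σ j

  StatePath-≤ : ∀ {n k σ} → StatePath n σ → k ≤ n → StatePath k σ
  StatePath-≤ path k≤n = record
    { start-Â   = start-Â
    ; start-bwd = start-bwd
    ; steps     = λ i<k → steps (≤-trans i<k k≤n)
    ; injective = λ i<j j≤k → injective i<j (≤-trans j≤k k≤n)
    }
    where open StatePath path

  StatePath-extend : ∀ {n σ τ} → StatePath n σ → σ n ⟶ τ → (∀ {k} → k ≤ n → σ k ≢ τ) →
                     StatePath (suc n) (extend n σ τ)
  StatePath-extend {n} {σ} {τ} path σn⟶τ fresh = record
    { start-Â   = subst (Â ∘ proj₁) (sym (below z≤n)) start-Â
    ; start-bwd = trans (cong proj₂ (below z≤n)) start-bwd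
    ; steps     = steps⁺
    ; injective = injective⁺
    }
    where
    open StatePath path

    σ⁺ : ℕ → State
    σ⁺ = extend n σ τ

    below : ∀ {k} → k ≤ n → σ⁺ k ≡ σ k
    below = extend-≤ σ τ

    top : σ⁺ (suc n) ≡ τ
    top = extend-suc n σ τ

    steps⁺ : ∀ {i} → i < suc n → σ⁺ i ⟶ σ⁺ (suc i)
    steps⁺ i<1+n with m<1+n⇒m<n∨m≡n i<1+n
    ... | inj₁ i<n  = subst₂ _⟶_ (sym (below (<⇒≤ i<n))) (sym (below i<n)) (steps i<n)
    ... | inj₂ refl = subst₂ _⟶_ (sym (below ≤-refl)) (sym top) σn⟶τ

    injective⁺ : ∀ {i j} → i < j → j ≤ suc n → σ⁺ i ≢ σ⁺ j
    injective⁺ i<j j≤1+n σ⁺i≡σ⁺j with m≤n⇒m<n∨m≡n j≤1+n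
    ... | inj₁ (s≤s j≤n) =
      injective i<j j≤n (trans (sym (below (<⇒≤ (<-≤-trans i<j j≤n)))) (trans σ⁺i≡σ⁺j (below j≤n)))
    ... | inj₂ refl = fresh (m<1+n⇒m≤n i<j) (trans (sym (below (m<1+n⇒m≤n i<j))) (trans σ⁺i≡σ⁺j top))

  -- Excluded middle decides whether the new state was visited before: if so, cut the
  -- walk there, otherwise extend it.
  reachable⇒StatePath : ExcludedMiddle 0ℓ →
                        ∀ {τ} → Reachable τ → ∃₂ λ n σ → StatePath n σ × σ n ≡ τ
  reachable⇒StatePath em (start {a} â) = 0 , (λ _ → a , bwd) , path₀ , refl
    where
    path₀ : StatePath 0 (λ _ → a , bwd)
    path₀ = record
      { start-Â = â ; start-bwd = refl ; steps = λ ()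
      ; injective = λ i<j j≤0 _ → n≮0 (<-≤-trans i<j j≤0) }
  reachable⇒StatePath em (step {τ = τ} r st) with reachable⇒StatePath em r
  ... | n , σ , path , refl with em {∃ λ k → k ≤ n × σ k ≡ τ}
  ...   | yes (k , k≤n , σk≡τ) = k , σ , StatePath-≤ path k≤n , σk≡τ
  ...   | no  unvisited        =
    suc n , extend n σ τ ,
    StatePath-extend path st (λ k≤n σk≡τ → unvisited (_ , k≤n , σk≡τ)) , extend-suc n σ τ

  module _ {n σ} (path : StatePath n σ) where
    open StatePath path

    private
      w : ℕ → V
      w = proj₁ ∘ σ

      μ : ℕ → Mode
      μ = proj₂ ∘ σ

    bwd⇒A⊎VP : ∀ {k} → k ≤ n → μ k ≡ bwd → A (w k) ⊎ VP (w k)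
    bwd⇒A⊎VP {zero}  _   _      = inj₁ (proj₁ start-Â)
    bwd⇒A⊎VP {suc k} k<n μk≡bwd = inj₂ (entered-bwd⇒VP (steps k<n) μk≡bwd)

    fwd⇒¬A : ∀ {k} → k ≤ n → μ k ≡ fwd → ¬ A (w k)
    fwd⇒¬A {zero}  _   μ0≡fwd = contradiction (trans (sym μ0≡fwd) start-bwd) fwd≢bwd
    fwd⇒¬A {suc k} k<n μk≡fwd = entered-fwd⇒¬A (steps k<n) μk≡fwd

    both-modes⇒VP : ∀ {k k′} → k ≤ n → k′ ≤ n →
                    w k ≡ w k′ → μ k ≡ bwd → μ k′ ≡ fwd → VP (w k)
    both-modes⇒VP k≤n k′≤n wk≡wk′ μk≡bwd μk′≡fwd with bwd⇒A⊎VP k≤n μk≡bwd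
    ... | inj₁ a  = contradiction (subst A wk≡wk′ a) (fwd⇒¬A k′≤n μk′≡fwd)
    ... | inj₂ vp = vp

    repeated⇒VP : ∀ {i j} → i < j → j ≤ n → w i ≡ w j → VP (w i)
    repeated⇒VP {i} {j} i<j j≤n wi≡wj with μ i in μi | μ j in μj
    ... | fwd | fwd = contradiction (cong₂ _,_ wi≡wj (trans μi (sym μj))) (injective i<j j≤n)
    ... | bwd | bwd = contradiction (cong₂ _,_ wi≡wj (trans μi (sym μj))) (injective i<j j≤n)
    ... | bwd | fwd = both-modes⇒VP (<⇒≤ (<-≤-trans i<j j≤n)) j≤n wi≡wj μi μj
    ... | fwd | bwd =
      subst VP (sym wi≡wj) (both-modes⇒VP j≤n (<⇒≤ (<-≤-trans i<j j≤n)) (sym wi≡wj) μj μi)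

    edges-distinct : ∀ {i j} → i < j → j < n → ¬ (w i ≡ w j × w (suc i) ≡ w (suc j))
    edges-distinct i<j j<n (wi≡wj , wi+1≡wj+1) =
      injective (s≤s i<j) j<n
        (cong₂ _,_ wi+1≡wj+1 (step-mode-unique (steps (<-trans i<j j<n)) (steps j<n) wi≡wj wi+1≡wj+1))

    forward-into-VP⇒backward :
      ∀ k → suc k < n → VP (w (suc k)) → E* (w k) (w (suc k)) × E (w k) (w (suc k)) →
      E* (w (suc k)) (w (suc (suc k))) × ¬ E (w (suc k)) (w (suc (suc k)))
    forward-into-VP⇒backward k k+1<n vp (_ , e) with steps (<-trans (n<1+n k) k+1<n) | steps k+1<n
    ... | backward ep _ | _ = contradiction (EP⇒E ep) (asym _ _ e)
    ... | forward _ _ _ μk+1≡fwd | forward _ _ (inj₁ μk+1≡bwd) _ =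
      contradiction (trans (sym μk+1≡fwd) μk+1≡bwd) fwd≢bwd
    ... | forward _ _ _ _ | forward _ _ (inj₂ ¬vp) _ = contradiction vp ¬vp
    ... | forward _ _ _ _ | backward ep _ = inj₂ (EP⇒E ep , ep) , λ e′ → asym _ _ e′ (EP⇒E ep)

    alternating : ¬ VP (w n) → IsAltTrail n w
    alternating ¬vp =
      (λ i i<n → step-E* (steps i<n)) ,
      (λ i j i<j j<n → edges-distinct i<j j<n) ,
      start-Â ,
      (λ i j i<j j≤n wi≡wj → repeated⇒VP i<j j≤n wi≡wj , λ j≡n →
         ¬vp (subst (VP ∘ w) j≡n (subst VP wi≡wj (repeated⇒VP i<j j≤n wi≡wj)))) ,
      forward-into-VP⇒backward

  augmenting-trail : ExcludedMiddle 0ℓ → ∀ {b m} → Reachable (b , m) → B b → ¬ VP b →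
                     Σ ℕ λ n → Σ (ℕ → V) λ w → IsAugmenting n w
  augmenting-trail em r b∈B ¬vp with reachable⇒StatePath em r
  ... | n , σ , path , refl =
    n , proj₁ ∘ σ , alternating path ¬vp ,
    b∈B , λ (i , ter≡b) → ¬vp (i , subst (_∈ verts D (P i)) ter≡b (lastOf-∈ _ _))

module Hindrance (em : ExcludedMiddle 0ℓ)
  (D : Digraph) (A B : Digraph.V D → Set) (web : IsWeb D A B)
  {I : Set} (P : I → Path D) (linkage : IsPartialLinkage D A B P) where
  open Digraph D
  open Linked-Web D A B P
  open AlternatingReachability D A B web P

  Reached : V → Set
  Reached v = ∃ λ m → Reachable (v , m)

  module Cut (i : I) = LastSplit (splitAtLast {Pr = Reached} (λ _ → em) (ini D (P i)) (Path.rest (P i)))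
  open Cut

  H : I → Path D
  H i = initialSegment (P i) (prefix i) (suffix i , l≡prefix++suffix i)

  S : V → Set
  S v = ∃ λ i → ter D (H i) ≡ v

  Inner : I → V → Set
  Inner i v = v ∈ dropLast (verts D (H i))

  verts-P : ∀ i → verts D (P i) ≡ verts D (H i) ++ suffix i
  verts-P i = cong (ini D (P i) ∷_) (l≡prefix++suffix i)

  H⊆P : ∀ {i v} → v ∈ verts D (H i) → v ∈ verts D (P i)
  H⊆P {i} {v} v∈H = subst (v ∈_) (sym (verts-P i)) (∈-++⁺ˡ v∈H)

  H-edge⇒P-edge : ∀ {i u v} → Consecutive (verts D (H i)) u v → EdgeOn D (P i) u v
  H-edge⇒P-edge {i} {u} {v} uv =
    subst (λ l → Consecutive l u v) (sym (verts-P i)) (Consecutive-++⁺ˡ (suffix i) uv)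

  reached⇒∈H : ∀ {i v} → v ∈ verts D (P i) → Reached v → v ∈ verts D (H i)
  reached⇒∈H {i} {v} v∈P r with ∈-++⁻ (verts D (H i)) (subst (v ∈_) (verts-P i) v∈P)
  ... | inj₁ v∈H      = v∈H
  ... | inj₂ v∈suffix = contradiction r (All.lookup (¬Pr-in-suffix i) v∈suffix)

  ∈H⇒Inner : ∀ {i v} → v ∈ verts D (H i) → ¬ S v → Inner i v
  ∈H⇒Inner {i} v∈H ¬s = ∈-dropLast⁺ _ _ v∈H λ v≡ter → ¬s (i , sym v≡ter)

  reached⇒Inner : ∀ {i v} → v ∈ verts D (P i) → Reached v → ¬ S v → Inner i v
  reached⇒Inner v∈P r ¬s = ∈H⇒Inner (reached⇒∈H v∈P r) ¬s

  Inner⇒¬S : ∀ {i v} → Inner i v → ¬ S v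
  Inner⇒¬S {i} inner (k , ter≡v) with em {k ≡ i}
  ... | yes refl = ∈-dropLast⇒≢lastOf (Path.unique (H i)) inner (sym ter≡v)
  ... | no  k≢i  = proj₂ linkage k i k≢i _
                     (H⊆P (subst (_∈ verts D (H k)) ter≡v (lastOf-∈ _ _)))
                     (H⊆P (∈-dropLast⁻ _ inner))

  Inner⇒bwd : ∀ {i v} → Inner i v → Reachable (v , bwd)
  Inner⇒bwd {i} {v} inner with Pr-at-end i
  ... | inj₁ empty = contradiction (subst (λ l → v ∈ dropLast (ini D (P i) ∷ l)) empty inner) λ ()
  ... | inj₂ reached = All.lookup (All-dropLast-backward back (bwd ,_) edges reached) inner
    where
    back : ∀ {x y} → EdgeOn D (P i) x y → Reached y → Reachable (x , bwd)
    back xy (_ , r) = step r (backward (i , xy) refl)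

    edges : Linked (EdgeOn D (P i)) (verts D (H i))
    edges = Linked-++⁻ˡ (verts D (H i))
              (subst (Linked (EdgeOn D (P i))) (verts-P i) (Linked-Consecutive (verts D (P i))))

  Inner-successor : ∀ {i u v} → Inner i u → EdgeOn D (P i) u v → v ∈ verts D (H i)
  Inner-successor {i} inner uv with ∈-dropLast⇒successor _ inner
  ... | w , uw = subst (_∈ verts D (H i)) (Consecutive-unique (Path.unique (P i)) (H-edge⇒P-edge uw) uv)
                   (Consecutive⇒∈ʳ uw)

  Inner⇒out-edge : ∀ {i v} → Inner i v → ∃ (E v)
  Inner⇒out-edge {i} inner = map₂ (lookup-Consecutive (Path.linked (H i))) (∈-dropLast⇒successor _ inner)

  Extendable : V → Set
  Extendable v = ∃ λ m → Reachable (v , m) × ForwardOK v m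

  Inner⇒Extendable : ∀ {i v} → Inner i v → Extendable v
  Inner⇒Extendable inner = bwd , Inner⇒bwd inner , inj₁ refl

  A⇒Extendable : ∀ {a} → A a → ¬ S a → Extendable a
  A⇒Extendable {a} a∈A ¬s with em {∃ λ i → ini D (P i) ≡ a}
  ... | no  ¬ini       = bwd , start (a∈A , ¬ini) , inj₁ refl
  ... | yes (i , refl) = Inner⇒Extendable (∈H⇒Inner {i} (here refl) ¬s)

  fwd⇒Extendable : ∀ {v} → Reachable (v , fwd) → ¬ S v → Extendable v
  fwd⇒Extendable {v} r ¬s with em {VP v}
  ... | yes (i , v∈P) = Inner⇒Extendable (reached⇒Inner v∈P (fwd , r) ¬s)
  ... | no  ¬vp       = fwd , r , inj₂ ¬vp

  Extendable-step : ∀ {u v} → E u v → ¬ S u → ¬ S v → Extendable u → Extendable v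
  Extendable-step {u} {v} e ¬su ¬sv (m , r , ok) with em {EP u v}
  ... | yes (i , uv) =
    Inner⇒Extendable (∈H⇒Inner (Inner-successor (reached⇒Inner (Consecutive⇒∈ˡ uv) (m , r) ¬su) uv) ¬sv)
  ... | no ¬ep = fwd⇒Extendable (step r (forward e ¬ep ok refl)) ¬sv

  module _ (no-augmenting : ¬ (Σ ℕ λ n → Σ (ℕ → V) λ w → IsAugmenting n w)) where

    separates : IsSeparator D A B S
    separates Q (a∈A , b∈B , _) with em {∃ λ v → v ∈ verts D Q × S v}
    ... | yes hit = hit
    ... | no  miss = contradiction (augmenting-trail em (proj₁ (proj₂ end)) b∈B ¬vp) no-augmenting
      where
      avoids : All (¬_ ∘ S) (verts D Q)
      avoids = All.tabulate λ v∈Q s → miss (_ , v∈Q , s)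

      end : Extendable (ter D Q)
      end = lastOf-forward Extendable-step (Path.linked Q) avoids (A⇒Extendable a∈A (All.head avoids))

      ¬vp : ¬ VP (ter D Q)
      ¬vp (i , b∈P)
        with Inner⇒out-edge (reached⇒Inner b∈P (map₂ proj₁ end) (All.lookup avoids (lastOf-∈ _ _)))
      ... | _ , e = proj₂ web _ _ e b∈B

    hindered : ∃ Â → Hindered D A B
    hindered â = I , H , S , disjoint , AS-paths , separates , (λ _ → id , id) , ini∈A , â
      where
      disjoint : PairwiseDisjoint D H
      disjoint i j i≢j v v∈Hi v∈Hj = proj₂ linkage i j i≢j v (H⊆P v∈Hi) (H⊆P v∈Hj)

      ini∈A : ∀ v → (∃ λ j → ini D (H j) ≡ v) → A v
      ini∈A _ (j , refl) = proj₁ (proj₁ linkage j)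

      interior-¬A : ∀ {j v} → v ∈ interior D (H j) → ¬ A v
      interior-¬A {j} v∈int with ∈⇒predecessor _ (∈-dropLast⁻ (prefix j) v∈int)
      ... | _ , uv = proj₁ web _ _ (lookup-Consecutive (Path.linked (H j)) uv)

      AS-paths : ∀ j → IsXYPath D A S (H j)
      AS-paths j = proj₁ (proj₁ linkage j) , (j , refl) ,
        All.tabulate λ v∈int → interior-¬A v∈int , Inner⇒¬S (∈-dropLast-∷ (prefix j) v∈int)

lemma3p2 : ExcludedMiddle 0ℓ →
    (D : Digraph) → (A B : Digraph.V D → Set) → IsWeb D A B →
    {I : Set} → (P : I → Path D) → IsPartialLinkage D A B P →
    (∃ λ a → Linked-Web.Â D A B P a) →
    ¬ (Σ ℕ λ n → Σ (ℕ → Digraph.V D) λ w → Linked-Web.IsAugmenting D A B P n w) →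
    Hindered D A B
lemma3p2 em D A B web P linkage Â-nonempty no-augmenting =
  Hindrance.hindered em D A B web P linkage no-augmenting Â-nonempty
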